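{- $({\mathbb S}^{\infty}[X],+,\cdot,0,1)$ is absorptive, fully continuous, and chain-positive.
   Context: Semirings are commutative and naturally ordered; $\bigsqcup$ and $\inf$ denote suprema and infima in the natural order. A semiring is absorptive if $a+ab=a$ for all $a,b$; fully chain-complete if every chain has a supremum and infimum; fully continuous if additionally $+$ and $\cdot$ preserve suprema and infima of nonempty chains in each argument; chain-positive (for fully chain-complete semirings) if for every nonempty chain $C$ of non-zero elements, $\inf C \neq 0$. For a finite set $X$, monomials are functions $m:X\to{\mathbb N}\cup\{\infty\}$ with multiplication adding exponents; $m_2 \succeq m_1$ ($m_2$ absorbs $m_1$) if $m_2(x)\le m_1(x)$ for all $x$. ${\mathbb S}^{\infty}[X]$ is the set of antichains of monomials under $\succeq$, written as formal sums, with polynomial addition and multiplication keeping only $\succeq$-maximal monomials and disregarding coefficients. -}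

module Defs where

open import Level using (Level; 0ℓ)
open import Data.Nat using (ℕ; _≤_; _≤?_) renaming (_+_ to _+ℕ_)
open import Data.Fin using (Fin)
open import Data.Vec using (Vec; replicate; zipWith)
open import Data.Vec.Relation.Binary.Pointwise.Inductive as PW using (Pointwise)
open import Data.List using (List; []; _∷_; filter; cartesianProductWith; _++_)
open import Data.List.Membership.Propositional using (_∈_)
open import Data.List.Relation.Unary.All as All using (All; []; _∷_)
open import Data.List.Relation.Unary.All.Properties as AllP using (all-filter)
open import Data.List.Relation.Unary.All.Properties.Core using (¬Any⇒All¬)
open import Data.List.Relation.Unary.Any using (any?)
open import Data.List.Relation.Unary.AllPairs using (AllPairs; []; _∷_)
import Data.List.Relation.Unary.AllPairs.Properties as APP
open import Data.Product using (Σ; ∃; _×_; _,_; proj₁; proj₂)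
open import Data.Sum using (_⊎_)
open import Relation.Nullary using (¬_; Dec; yes; no; ¬?)
open import Relation.Binary.PropositionalEquality using (_≡_)

data ℕ∞ : Set where
  fin : ℕ → ℕ∞
  ∞   : ℕ∞

data _≤∞_ : ℕ∞ → ℕ∞ → Set where
  fin≤fin : ∀ {m n} → m ≤ n → fin m ≤∞ fin n
  _≤∞∞    : ∀ x → x ≤∞ ∞

_≤∞?_ : ∀ x y → Dec (x ≤∞ y)
x     ≤∞? ∞     = yes (x ≤∞∞)
∞     ≤∞? fin n = no λ ()
fin m ≤∞? fin n with m ≤? n
... | yes p = yes (fin≤fin p)
... | no ¬p = no λ { (fin≤fin p) → ¬p p }

_+∞_ : ℕ∞ → ℕ∞ → ℕ∞
fin m +∞ fin n = fin (m +ℕ n)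
fin m +∞ ∞     = ∞
∞     +∞ _     = ∞

-- Monomials over the finite set of variables X = Fin n:
-- maps X → ℕ ∪ {∞}, represented as vectors of exponents.

Mon : ℕ → Set
Mon n = Vec ℕ∞ n

_·m_ : ∀ {n} → Mon n → Mon n → Mon n
_·m_ = zipWith _+∞_

oneM : ∀ {n} → Mon n
oneM = replicate _ (fin 0)

-- m₂ ⪰ m₁  (m₂ absorbs m₁)  iff  m₂(x) ≤ m₁(x) for all x
_⪰_ : ∀ {n} → Mon n → Mon n → Set
m₂ ⪰ m₁ = Pointwise _≤∞_ m₂ m₁

_⪰?_ : ∀ {n} (m₂ m₁ : Mon n) → Dec (m₂ ⪰ m₁)
_⪰?_ = PW.decidable _≤∞?_

Incomparable : ∀ {n} → Mon n → Mon n → Set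
Incomparable a b = ¬ (a ⪰ b) × ¬ (b ⪰ a)

Antichain : ∀ {n} → List (Mon n) → Set
Antichain = AllPairs Incomparable

maxs : ∀ {n} → List (Mon n) → List (Mon n)
maxs [] = []
maxs (m ∷ l) with any? (λ p → p ⪰? m) (maxs l)
... | yes _ = maxs l
... | no _  = m ∷ filter (λ p → ¬? (m ⪰? p)) (maxs l)

maxs-antichain : ∀ {n} (l : List (Mon n)) → Antichain (maxs l)
maxs-antichain [] = []
maxs-antichain (m ∷ l) with any? (λ p → p ⪰? m) (maxs l)
... | yes _ = maxs-antichain l
... | no ¬a = All.zip (all-filter (λ p → ¬? (m ⪰? p)) (maxs l)
                      , AllP.filter⁺ (λ p → ¬? (m ⪰? p)) (¬Any⇒All¬ (maxs l) ¬a))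
              ∷ APP.filter⁺ (λ p → ¬? (m ⪰? p)) (maxs-antichain l)

S∞ : ℕ → Set
S∞ n = Σ (List (Mon n)) Antichain

_≈S_ : ∀ {n} → S∞ n → S∞ n → Set
P ≈S Q = ∀ m → (m ∈ proj₁ P → m ∈ proj₁ Q) × (m ∈ proj₁ Q → m ∈ proj₁ P)

normal : ∀ {n} → List (Mon n) → S∞ n
normal l = maxs l , maxs-antichain l

_+S_ : ∀ {n} → S∞ n → S∞ n → S∞ n
P +S Q = normal (proj₁ P ++ proj₁ Q)

_·S_ : ∀ {n} → S∞ n → S∞ n → S∞ n
P ·S Q = normal (cartesianProductWith _·m_ (proj₁ P) (proj₁ Q))

0S : ∀ {n} → S∞ n
0S = [] , []

1S : ∀ {n} → S∞ n
1S = oneM ∷ [] , (All.[] ∷ [])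

module SemiringNotions {A : Set} (_≈_ : A → A → Set)
  (_+_ _·_ : A → A → A) (𝟘 𝟙 : A) where

  _⊑_ : A → A → Set
  a ⊑ b = ∃ λ c → (a + c) ≈ b

  Absorptive : Set
  Absorptive = ∀ a b → (a + (a · b)) ≈ a

  IsChain : (A → Set) → Set
  IsChain C = ∀ a b → C a → C b → a ⊑ b ⊎ b ⊑ a

  NonEmpty : (A → Set) → Set
  NonEmpty C = ∃ λ a → C a

  IsSup : (A → Set) → A → Set
  IsSup C s = (∀ a → C a → a ⊑ s) × (∀ u → (∀ a → C a → a ⊑ u) → s ⊑ u)

  IsInf : (A → Set) → A → Set
  IsInf C i = (∀ a → C a → i ⊑ a) × (∀ l → (∀ a → C a → l ⊑ a) → l ⊑ i)

  Image : (A → A) → (A → Set) → A → Set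
  Image f C y = ∃ λ c → C c × (y ≈ f c)

  FullyChainComplete : Set₁
  FullyChainComplete = ∀ C → IsChain C → (∃ λ s → IsSup C s) × (∃ λ i → IsInf C i)

  PreservesChainLimits : (A → A) → Set₁
  PreservesChainLimits f = ∀ C → IsChain C → NonEmpty C →
    (∀ s → IsSup C s → IsSup (Image f C) (f s)) ×
    (∀ i → IsInf C i → IsInf (Image f C) (f i))

  FullyContinuous : Set₁
  FullyContinuous = FullyChainComplete ×
    (∀ a → PreservesChainLimits (λ x → a + x) × PreservesChainLimits (λ x → x + a)
         × PreservesChainLimits (λ x → a · x) × PreservesChainLimits (λ x → x · a))

  ChainPositive : Set₁
  ChainPositive = ∀ C → IsChain C → NonEmpty C → (∀ c → C c → ¬ (c ≈ 𝟘)) →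
    ∀ i → IsInf C i → ¬ (i ≈ 𝟘)

module Submission where

-- A polynomial of 𝕊∞[X] is determined by the down-set of monomials it absorbs, and this turns
-- + and · into union and the pointwise product of down-sets, where the semiring laws and
-- absorption are easy. The natural order becomes inclusion, so suprema and infima of a family are
-- its union and intersection, provided these are again finitely generated: that is Dickson's
-- lemma, with ∞ as an extra exponent. Multiplication by a fixed polynomial commutes with the
-- intersection of a chain because, by pigeonhole over its finitely many monomials, one of them
-- works for the whole chain, and exponent subtraction then yields a common cofactor. Finally the
-- monomial with all exponents ∞ is absorbed by every non-zero polynomial, so it survives in the
-- infimum of non-zero polynomials.

open import Defs
open import Level using (0ℓ)
open import Axiom.ExcludedMiddle using (ExcludedMiddle)
open import Axiom.DoubleNegationElimination using (em⇒dne)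
open import Algebra.Structures using (IsCommutativeMonoid; IsCommutativeSemiring)
import Algebra.Definitions as AlgebraDefinitions
import Algebra.Structures.Biased as Biased
open import Data.Empty using (⊥-elim)
open import Data.Nat as ℕ using (ℕ; zero; suc; _≤_; _∸_; _⊔_; _≤?_; s≤s)
import Data.Nat.Properties as ℕ
open import Data.Vec using ([]; _∷_; replicate; zipWith)
import Data.Vec.Properties as Vec
open import Data.Vec.Relation.Binary.Pointwise.Inductive as PW using ([]; _∷_)
open import Data.List using (List; []; _∷_; _++_; map; filter; concatMap; cartesianProductWith; upTo)
open import Data.List.Membership.Propositional using (_∈_; find; lose)
open import Data.List.Membership.Propositional.Properties
  using (∈-filter⁺; ∈-filter⁻; ∈-map⁻; ∈-concatMap⁻; ∈-upTo⁺;
         ∈-cartesianProductWith⁺; ∈-cartesianProductWith⁻)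
open import Data.List.Relation.Unary.Any as Any using (Any; here; there; any?)
import Data.List.Relation.Unary.Any.Properties as Any
open import Data.List.Relation.Unary.All as All using (All)
open import Data.List.Relation.Unary.AllPairs using ([]; _∷_)
open import Data.Product using (Σ; ∃; ∃₂; _×_; _,_; proj₁; proj₂)
open import Data.Sum as Sum using (_⊎_; inj₁; inj₂; [_,_])
open import Function using (id; _∘_)
open import Relation.Nullary using (¬_; yes; no; ¬?)
open import Relation.Binary.Definitions using (Reflexive; Transitive; Antisymmetric)
open import Relation.Binary.Structures using (IsEquivalence)
open import Relation.Binary.PropositionalEquality using (_≡_; refl; sym; cong; cong₂; subst)
open import Relation.Unary using (Pred; _⊆_; _≐_; _∪_; ⋃; ⋂)
open import Relation.Unary.Properties using (≐-refl; ≐-sym; ≐-trans)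
open import Relation.Unary.Algebra using (∪-cong; ∪-comm; ∪-assoc)
open import Relation.Unary.Relation.Binary.Equality using (≐-setoid)
import Relation.Binary.Reasoning.Setoid as SetoidReasoning

≤∞-refl : Reflexive _≤∞_
≤∞-refl {fin n} = fin≤fin ℕ.≤-refl
≤∞-refl {∞}     = ∞ ≤∞∞

≤∞-trans : Transitive _≤∞_
≤∞-trans (fin≤fin p) (fin≤fin q) = fin≤fin (ℕ.≤-trans p q)
≤∞-trans _           (_ ≤∞∞)     = _ ≤∞∞

≤∞-antisym : Antisymmetric _≡_ _≤∞_
≤∞-antisym (fin≤fin p) (fin≤fin q) = cong fin (ℕ.≤-antisym p q)
≤∞-antisym (_ ≤∞∞)     (_ ≤∞∞)     = refl

+∞-comm : ∀ x y → x +∞ y ≡ y +∞ x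
+∞-comm (fin m) (fin n) = cong fin (ℕ.+-comm m n)
+∞-comm (fin m) ∞       = refl
+∞-comm ∞       (fin n) = refl
+∞-comm ∞       ∞       = refl

+∞-assoc : ∀ x y z → (x +∞ y) +∞ z ≡ x +∞ (y +∞ z)
+∞-assoc (fin m) (fin n) (fin k) = cong fin (ℕ.+-assoc m n k)
+∞-assoc (fin m) (fin n) ∞       = refl
+∞-assoc (fin m) ∞       z       = refl
+∞-assoc ∞       y       z       = refl

+∞-identityˡ : ∀ x → fin 0 +∞ x ≡ x
+∞-identityˡ (fin n) = refl
+∞-identityˡ ∞       = refl

+∞-mono-≤∞ : ∀ {x x′ y y′} → x ≤∞ x′ → y ≤∞ y′ → (x +∞ y) ≤∞ (x′ +∞ y′)
+∞-mono-≤∞ (fin≤fin p) (fin≤fin q) = fin≤fin (ℕ.+-mono-≤ p q)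
+∞-mono-≤∞ (fin≤fin p) (_ ≤∞∞)     = _ ≤∞∞
+∞-mono-≤∞ (_ ≤∞∞)     q           = _ ≤∞∞

x≤∞x+∞y : ∀ x y → x ≤∞ (x +∞ y)
x≤∞x+∞y (fin m) (fin n) = fin≤fin (ℕ.m≤m+n m n)
x≤∞x+∞y (fin m) ∞       = _ ≤∞∞
x≤∞x+∞y ∞       y       = _ ≤∞∞

-- The residual of _+∞_; the value of fin m ∸∞ ∞ is junk, a case excluded by x ≤∞ m below.
_∸∞_ : ℕ∞ → ℕ∞ → ℕ∞
fin m ∸∞ fin n = fin (m ∸ n)
_     ∸∞ _     = ∞

x+∞[m∸∞x]≤∞m : ∀ {x m} → x ≤∞ m → (x +∞ (m ∸∞ x)) ≤∞ m
x+∞[m∸∞x]≤∞m (fin≤fin x≤m) = fin≤fin (ℕ.≤-reflexive (ℕ.m+[n∸m]≡n x≤m))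
x+∞[m∸∞x]≤∞m (_ ≤∞∞)       = _ ≤∞∞

x+∞p≤∞m⇒p≤∞m∸∞x : ∀ x {p m} → (x +∞ p) ≤∞ m → p ≤∞ (m ∸∞ x)
x+∞p≤∞m⇒p≤∞m∸∞x x       {m = ∞}                 _            = _ ≤∞∞
x+∞p≤∞m⇒p≤∞m∸∞x (fin a) {fin c} {fin b} (fin≤fin le) =
  fin≤fin (ℕ.m+n≤o⇒m≤o∸n c (subst (_≤ b) (ℕ.+-comm a c) le))

⪰-refl : ∀ {n} → Reflexive (_⪰_ {n})
⪰-refl = PW.refl ≤∞-refl

⪰-trans : ∀ {n} → Transitive (_⪰_ {n})
⪰-trans = PW.trans ≤∞-trans

⪰-antisym : ∀ {n} → Antisymmetric _≡_ (_⪰_ {n})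
⪰-antisym []       []       = refl
⪰-antisym (p ∷ ps) (q ∷ qs) = cong₂ _∷_ (≤∞-antisym p q) (⪰-antisym ps qs)

·m-comm : ∀ {n} (a b : Mon n) → a ·m b ≡ b ·m a
·m-comm = Vec.zipWith-comm +∞-comm

·m-assoc : ∀ {n} (a b c : Mon n) → (a ·m b) ·m c ≡ a ·m (b ·m c)
·m-assoc = Vec.zipWith-assoc +∞-assoc

·m-identityˡ : ∀ {n} (a : Mon n) → oneM ·m a ≡ a
·m-identityˡ = Vec.zipWith-identityˡ +∞-identityˡ

·m-mono-⪰ : ∀ {n} {a a′ b b′ : Mon n} → a ⪰ a′ → b ⪰ b′ → (a ·m b) ⪰ (a′ ·m b′)
·m-mono-⪰ = PW.zipWith-cong +∞-mono-≤∞

a⪰a·b : ∀ {n} (a b : Mon n) → a ⪰ (a ·m b)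
a⪰a·b []      []      = []
a⪰a·b (x ∷ a) (y ∷ b) = x≤∞x+∞y x y ∷ a⪰a·b a b

_∸m_ : ∀ {n} → Mon n → Mon n → Mon n
_∸m_ = zipWith _∸∞_

x·[m∸x]⪰m : ∀ {n} {x m : Mon n} → x ⪰ m → (x ·m (m ∸m x)) ⪰ m
x·[m∸x]⪰m []       = []
x·[m∸x]⪰m (p ∷ ps) = x+∞[m∸∞x]≤∞m p ∷ x·[m∸x]⪰m ps

x·p⪰m⇒p⪰m∸x : ∀ {n} {x p m : Mon n} → (x ·m p) ⪰ m → p ⪰ (m ∸m x)
x·p⪰m⇒p⪰m∸x {x = []}    {[]}    {[]}    []       = []
x·p⪰m⇒p⪰m∸x {x = a ∷ x} {_ ∷ p} {_ ∷ m} (q ∷ qs) = x+∞p≤∞m⇒p≤∞m∸∞x a q ∷ x·p⪰m⇒p⪰m∸x qs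

∞m : ∀ {n} → Mon n
∞m {n} = replicate n ∞

a⪰∞m : ∀ {n} (a : Mon n) → a ⪰ ∞m
a⪰∞m []      = []
a⪰∞m (x ∷ a) = (x ≤∞∞) ∷ a⪰∞m a

DownClosed : ∀ {n} → Pred (Mon n) 0ℓ → Set
DownClosed U = ∀ {u w} → U u → u ⪰ w → U w

↓ : ∀ {n} → List (Mon n) → Pred (Mon n) 0ℓ
↓ l m = Any (_⪰ m) l

↓-downClosed : ∀ {n} {l : List (Mon n)} → DownClosed (↓ l)
↓-downClosed d u⪰w = Any.map (λ p⪰u → ⪰-trans p⪰u u⪰w) d

∈⇒↓ : ∀ {n} {l : List (Mon n)} {x} → x ∈ l → ↓ l x
∈⇒↓ x∈l = lose x∈l ⪰-refl

↓-least : ∀ {n} {U : Pred (Mon n) 0ℓ} {l} → DownClosed U → (∀ {x} → x ∈ l → U x) → ↓ l ⊆ U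
↓-least U↓ l⊆U d with find d
... | _ , x∈l , x⪰m = U↓ (l⊆U x∈l) x⪰m

⋃-downClosed : ∀ {n} {I : Set} {U : I → Pred (Mon n) 0ℓ} → (∀ i → DownClosed (U i)) → DownClosed (⋃ I U)
⋃-downClosed U↓ (i , Uiu) u⪰w = i , U↓ i Uiu u⪰w

⋂-downClosed : ∀ {n} {I : Set} {U : I → Pred (Mon n) 0ℓ} → (∀ i → DownClosed (U i)) → DownClosed (⋂ I U)
⋂-downClosed U↓ Uu u⪰w i = U↓ i (Uu i) u⪰w

↓-++ : ∀ {n} (a b : List (Mon n)) → ↓ (a ++ b) ≐ ↓ a ∪ ↓ b
↓-++ a b = Any.++⁻ a , [ Any.++⁺ˡ , Any.++⁺ʳ a ]

↓-∷-filter⁺ : ∀ {n} (m : Mon n) l → ↓ l ⊆ ↓ (m ∷ filter (λ p → ¬? (m ⪰? p)) l)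
↓-∷-filter⁺ m l d with find d
... | p , p∈l , p⪰x with m ⪰? p
...   | yes m⪰p = here (⪰-trans m⪰p p⪰x)
...   | no  m⋡p = there (lose (∈-filter⁺ (λ p → ¬? (m ⪰? p)) p∈l m⋡p) p⪰x)

maxs-⊆ : ∀ {n} (l : List (Mon n)) {x} → x ∈ maxs l → x ∈ l
maxs-⊆ (m ∷ l) x∈ with any? (λ p → p ⪰? m) (maxs l)
maxs-⊆ (m ∷ l) x∈          | yes _ = there (maxs-⊆ l x∈)
maxs-⊆ (m ∷ l) (here refl) | no  _ = here refl
maxs-⊆ (m ∷ l) (there x∈)  | no  _ = there (maxs-⊆ l (proj₁ (∈-filter⁻ (λ p → ¬? (m ⪰? p)) x∈)))

maxs-dominates : ∀ {n} (l : List (Mon n)) {x} → x ∈ l → ↓ (maxs l) x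
maxs-dominates (m ∷ l) x∈ with any? (λ p → p ⪰? m) (maxs l)
maxs-dominates (m ∷ l) (here refl) | yes m↓ = m↓
maxs-dominates (m ∷ l) (there x∈)  | yes _  = maxs-dominates l x∈
maxs-dominates (m ∷ l) (here refl) | no  _  = here ⪰-refl
maxs-dominates (m ∷ l) (there x∈)  | no  _  = ↓-∷-filter⁺ m (maxs l) (maxs-dominates l x∈)

↓-maxs : ∀ {n} (l : List (Mon n)) → ↓ (maxs l) ≐ ↓ l
↓-maxs l = ↓-least ↓-downClosed (λ x∈ → ∈⇒↓ (maxs-⊆ l x∈)) , ↓-least ↓-downClosed (maxs-dominates l)

infixr 7 _⊙_

_⊙_ : ∀ {n} → Pred (Mon n) 0ℓ → Pred (Mon n) 0ℓ → Pred (Mon n) 0ℓ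
(U ⊙ V) m = ∃₂ λ a b → U a × V b × (a ·m b) ⪰ m

↓-cartesianProduct : ∀ {n} (a b : List (Mon n)) → ↓ (cartesianProductWith _·m_ a b) ≐ ↓ a ⊙ ↓ b
↓-cartesianProduct a b = to , from
  where
  to : ↓ (cartesianProductWith _·m_ a b) ⊆ ↓ a ⊙ ↓ b
  to d with find d
  ... | _ , xy∈ , xy⪰m with ∈-cartesianProductWith⁻ _·m_ a b xy∈
  ...   | x , y , x∈ , y∈ , refl = x , y , ∈⇒↓ x∈ , ∈⇒↓ y∈ , xy⪰m

  from : ↓ a ⊙ ↓ b ⊆ ↓ (cartesianProductWith _·m_ a b)
  from (x , y , dx , dy , xy⪰m) with find dx | find dy
  ... | p , p∈ , p⪰x | q , q∈ , q⪰y =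
    lose (∈-cartesianProductWith⁺ _·m_ p∈ q∈) (⪰-trans (·m-mono-⪰ p⪰x q⪰y) xy⪰m)

module _ {n : ℕ} where

  ⊙-mono : ∀ {U U′ V V′ : Pred (Mon n) 0ℓ} → U ⊆ U′ → V ⊆ V′ → U ⊙ V ⊆ U′ ⊙ V′
  ⊙-mono U⊆U′ V⊆V′ (a , b , Ua , Vb , ab⪰m) = a , b , U⊆U′ Ua , V⊆V′ Vb , ab⪰m

  ⊙-cong : ∀ {U U′ V V′ : Pred (Mon n) 0ℓ} → U ≐ U′ → V ≐ V′ → U ⊙ V ≐ U′ ⊙ V′
  ⊙-cong (U⊆U′ , U′⊆U) (V⊆V′ , V′⊆V) = ⊙-mono U⊆U′ V⊆V′ , ⊙-mono U′⊆U V′⊆V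

  ⊙-comm : ∀ (U V : Pred (Mon n) 0ℓ) → U ⊙ V ≐ V ⊙ U
  ⊙-comm U V = swap , swap
    where
    swap : ∀ {U V} → U ⊙ V ⊆ V ⊙ U
    swap (a , b , Ua , Vb , ab⪰m) = b , a , Vb , Ua , subst (_⪰ _) (·m-comm a b) ab⪰m

  ⊙-assoc : ∀ (U V W : Pred (Mon n) 0ℓ) → (U ⊙ V) ⊙ W ≐ U ⊙ (V ⊙ W)
  ⊙-assoc U V W = to , from
    where
    to : (U ⊙ V) ⊙ W ⊆ U ⊙ (V ⊙ W)
    to (_ , c , (a , b , Ua , Vb , ab⪰x) , Wc , xc⪰m) =
      a , b ·m c , Ua , (b , c , Vb , Wc , ⪰-refl) ,
      subst (_⪰ _) (·m-assoc a b c) (⪰-trans (·m-mono-⪰ ab⪰x ⪰-refl) xc⪰m)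

    from : U ⊙ (V ⊙ W) ⊆ (U ⊙ V) ⊙ W
    from (a , _ , Ua , (b , c , Vb , Wc , bc⪰y) , ay⪰m) =
      a ·m b , c , (a , b , Ua , Vb , ⪰-refl) , Wc ,
      subst (_⪰ _) (sym (·m-assoc a b c)) (⪰-trans (·m-mono-⪰ ⪰-refl bc⪰y) ay⪰m)

  ⊙-identityˡ : ∀ {U : Pred (Mon n) 0ℓ} → DownClosed U → ↓ (oneM ∷ []) ⊙ U ≐ U
  ⊙-identityˡ U↓ =
    (λ (a , b , _ , Ub , ab⪰m) → U↓ Ub (⪰-trans (subst (b ⪰_) (·m-comm b a) (a⪰a·b b a)) ab⪰m)) ,
    (λ {m} Um → oneM , m , here ⪰-refl , Um , subst (_⪰ m) (sym (·m-identityˡ m)) ⪰-refl)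

  ⊙-distribʳ-∪ : ∀ (U V W : Pred (Mon n) 0ℓ) → (V ∪ W) ⊙ U ≐ (V ⊙ U) ∪ (W ⊙ U)
  ⊙-distribʳ-∪ U V W =
    (λ { (a , b , inj₁ Va , Ub , p) → inj₁ (a , b , Va , Ub , p)
       ; (a , b , inj₂ Wa , Ub , p) → inj₂ (a , b , Wa , Ub , p) }) ,
    [ ⊙-mono inj₁ id , ⊙-mono inj₂ id ]

  ∪-⊙-absorbs : ∀ {U : Pred (Mon n) 0ℓ} V → DownClosed U → U ∪ (U ⊙ V) ≐ U
  ∪-⊙-absorbs V U↓ = [ id , (λ (a , b , Ua , _ , ab⪰m) → U↓ Ua (⪰-trans (a⪰a·b a b) ab⪰m)) ] , inj₁

  module _ {I : Set} {U : I → Pred (Mon n) 0ℓ} where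

    ∪-⋃-distrib : ∀ (A : Pred (Mon n) 0ℓ) → I → A ∪ ⋃ I U ≐ ⋃ I (λ i → A ∪ U i)
    ∪-⋃-distrib A i₀ = [ (λ Am → i₀ , inj₁ Am) , (λ (i , Uim) → i , inj₂ Uim) ] ,
                       (λ (i , AUim) → Sum.map id (i ,_) AUim)

    ⊙-⋃-distrib : ∀ (A : Pred (Mon n) 0ℓ) → A ⊙ ⋃ I U ≐ ⋃ I (λ i → A ⊙ U i)
    ⊙-⋃-distrib A = (λ (a , b , Aa , (i , Uib) , p) → i , a , b , Aa , Uib , p) ,
                    (λ (i , a , b , Aa , Uib , p) → a , b , Aa , (i , Uib) , p)

-- Polynomials are determined by their down-sets

⟦_⟧ : ∀ {n} → S∞ n → Pred (Mon n) 0ℓ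
⟦ P ⟧ = ↓ (proj₁ P)

antichain-⪰⇒≡ : ∀ {n} {l : List (Mon n)} → Antichain l → ∀ {x y} → x ∈ l → y ∈ l → x ⪰ y → x ≡ y
antichain-⪰⇒≡ (_ ∷ _) (here refl) (here refl) _    = refl
antichain-⪰⇒≡ (h ∷ _) (here refl) (there y∈)  x⪰y  = ⊥-elim (proj₁ (All.lookup h y∈) x⪰y)
antichain-⪰⇒≡ (h ∷ _) (there x∈)  (here refl) x⪰y  = ⊥-elim (proj₂ (All.lookup h x∈) x⪰y)
antichain-⪰⇒≡ (_ ∷ t) (there x∈)  (there y∈)  x⪰y  = antichain-⪰⇒≡ t x∈ y∈ x⪰y

antichain-↓≐⇒⊆ : ∀ {n} {a b : List (Mon n)} → Antichain a → ↓ a ≐ ↓ b → ∀ {x} → x ∈ a → x ∈ b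
antichain-↓≐⇒⊆ a-anti (a⊆b , b⊆a) x∈a with find (a⊆b (∈⇒↓ x∈a))
... | y , y∈b , y⪰x with find (b⊆a (∈⇒↓ y∈b))
...   | z , z∈a , z⪰y with antichain-⪰⇒≡ a-anti z∈a x∈a (⪰-trans z⪰y y⪰x)
...     | refl = subst (_∈ _) (⪰-antisym y⪰x z⪰y) y∈b

module _ {n : ℕ} where

  ≐⇒≈S : ∀ (P Q : S∞ n) → ⟦ P ⟧ ≐ ⟦ Q ⟧ → P ≈S Q
  ≐⇒≈S P Q P≐Q _ = antichain-↓≐⇒⊆ (proj₂ P) P≐Q , antichain-↓≐⇒⊆ (proj₂ Q) (≐-sym P≐Q)

  ≈S⇒≐ : ∀ (P Q : S∞ n) → P ≈S Q → ⟦ P ⟧ ≐ ⟦ Q ⟧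
  ≈S⇒≐ P Q P≈Q = ↓-least ↓-downClosed (λ {x} → ∈⇒↓ ∘ proj₁ (P≈Q x)) ,
                 ↓-least ↓-downClosed (λ {x} → ∈⇒↓ ∘ proj₂ (P≈Q x))

  ⟦+S⟧ : ∀ (P Q : S∞ n) → ⟦ P +S Q ⟧ ≐ ⟦ P ⟧ ∪ ⟦ Q ⟧
  ⟦+S⟧ P Q = ≐-trans (↓-maxs _) (↓-++ (proj₁ P) (proj₁ Q))

  ⟦·S⟧ : ∀ (P Q : S∞ n) → ⟦ P ·S Q ⟧ ≐ ⟦ P ⟧ ⊙ ⟦ Q ⟧
  ⟦·S⟧ P Q = ≐-trans (↓-maxs _) (↓-cartesianProduct (proj₁ P) (proj₁ Q))

module _ {n : ℕ} where
  open AlgebraDefinitions (_≈S_ {n})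
  open SetoidReasoning (≐-setoid (Mon n) 0ℓ)
  open Biased (_≈S_ {n}) using (isCommutativeMonoidˡ; isCommutativeSemiringˡ)

  ≈S-isEquivalence : IsEquivalence (_≈S_ {n})
  ≈S-isEquivalence = record
    { refl  = λ _ → id , id
    ; sym   = λ P≈Q m → proj₂ (P≈Q m) , proj₁ (P≈Q m)
    ; trans = λ P≈Q Q≈R m → proj₁ (Q≈R m) ∘ proj₁ (P≈Q m) , proj₂ (P≈Q m) ∘ proj₂ (Q≈R m)
    }

  +S-cong : Congruent₂ _+S_
  +S-cong {P} {P′} {Q} {Q′} P≈P′ Q≈Q′ = ≐⇒≈S (P +S Q) (P′ +S Q′) (begin
    ⟦ P +S Q ⟧      ≈⟨ ⟦+S⟧ P Q ⟩
    ⟦ P ⟧ ∪ ⟦ Q ⟧   ≈⟨ ∪-cong (≈S⇒≐ P P′ P≈P′) (≈S⇒≐ Q Q′ Q≈Q′) ⟩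
    ⟦ P′ ⟧ ∪ ⟦ Q′ ⟧ ≈⟨ ⟦+S⟧ P′ Q′ ⟨
    ⟦ P′ +S Q′ ⟧    ∎)

  +S-assoc : Associative _+S_
  +S-assoc P Q R = ≐⇒≈S ((P +S Q) +S R) (P +S (Q +S R)) (begin
    ⟦ (P +S Q) +S R ⟧       ≈⟨ ⟦+S⟧ (P +S Q) R ⟩
    ⟦ P +S Q ⟧ ∪ ⟦ R ⟧      ≈⟨ ∪-cong (⟦+S⟧ P Q) ≐-refl ⟩
    (⟦ P ⟧ ∪ ⟦ Q ⟧) ∪ ⟦ R ⟧ ≈⟨ ∪-assoc ⟦ P ⟧ ⟦ Q ⟧ ⟦ R ⟧ ⟩
    ⟦ P ⟧ ∪ (⟦ Q ⟧ ∪ ⟦ R ⟧) ≈⟨ ∪-cong ≐-refl (⟦+S⟧ Q R) ⟨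
    ⟦ P ⟧ ∪ ⟦ Q +S R ⟧      ≈⟨ ⟦+S⟧ P (Q +S R) ⟨
    ⟦ P +S (Q +S R) ⟧       ∎)

  +S-comm : Commutative _+S_
  +S-comm P Q = ≐⇒≈S (P +S Q) (Q +S P) (begin
    ⟦ P +S Q ⟧    ≈⟨ ⟦+S⟧ P Q ⟩
    ⟦ P ⟧ ∪ ⟦ Q ⟧ ≈⟨ ∪-comm ⟦ P ⟧ ⟦ Q ⟧ ⟩
    ⟦ Q ⟧ ∪ ⟦ P ⟧ ≈⟨ ⟦+S⟧ Q P ⟨
    ⟦ Q +S P ⟧    ∎)

  +S-identityˡ : LeftIdentity 0S _+S_
  +S-identityˡ P = ≐⇒≈S (0S +S P) P (↓-maxs (proj₁ P))

  ·S-cong : Congruent₂ _·S_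
  ·S-cong {P} {P′} {Q} {Q′} P≈P′ Q≈Q′ = ≐⇒≈S (P ·S Q) (P′ ·S Q′) (begin
    ⟦ P ·S Q ⟧      ≈⟨ ⟦·S⟧ P Q ⟩
    ⟦ P ⟧ ⊙ ⟦ Q ⟧   ≈⟨ ⊙-cong (≈S⇒≐ P P′ P≈P′) (≈S⇒≐ Q Q′ Q≈Q′) ⟩
    ⟦ P′ ⟧ ⊙ ⟦ Q′ ⟧ ≈⟨ ⟦·S⟧ P′ Q′ ⟨
    ⟦ P′ ·S Q′ ⟧    ∎)

  ·S-assoc : Associative _·S_
  ·S-assoc P Q R = ≐⇒≈S ((P ·S Q) ·S R) (P ·S (Q ·S R)) (begin
    ⟦ (P ·S Q) ·S R ⟧       ≈⟨ ⟦·S⟧ (P ·S Q) R ⟩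
    ⟦ P ·S Q ⟧ ⊙ ⟦ R ⟧      ≈⟨ ⊙-cong (⟦·S⟧ P Q) ≐-refl ⟩
    (⟦ P ⟧ ⊙ ⟦ Q ⟧) ⊙ ⟦ R ⟧ ≈⟨ ⊙-assoc ⟦ P ⟧ ⟦ Q ⟧ ⟦ R ⟧ ⟩
    ⟦ P ⟧ ⊙ (⟦ Q ⟧ ⊙ ⟦ R ⟧) ≈⟨ ⊙-cong ≐-refl (⟦·S⟧ Q R) ⟨
    ⟦ P ⟧ ⊙ ⟦ Q ·S R ⟧      ≈⟨ ⟦·S⟧ P (Q ·S R) ⟨
    ⟦ P ·S (Q ·S R) ⟧       ∎)

  ·S-comm : Commutative _·S_
  ·S-comm P Q = ≐⇒≈S (P ·S Q) (Q ·S P) (begin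
    ⟦ P ·S Q ⟧    ≈⟨ ⟦·S⟧ P Q ⟩
    ⟦ P ⟧ ⊙ ⟦ Q ⟧ ≈⟨ ⊙-comm ⟦ P ⟧ ⟦ Q ⟧ ⟩
    ⟦ Q ⟧ ⊙ ⟦ P ⟧ ≈⟨ ⟦·S⟧ Q P ⟨
    ⟦ Q ·S P ⟧    ∎)

  ·S-identityˡ : LeftIdentity 1S _·S_
  ·S-identityˡ P = ≐⇒≈S (1S ·S P) P (begin
    ⟦ 1S ·S P ⟧    ≈⟨ ⟦·S⟧ 1S P ⟩
    ⟦ 1S ⟧ ⊙ ⟦ P ⟧ ≈⟨ ⊙-identityˡ ↓-downClosed ⟩
    ⟦ P ⟧          ∎)

  ·S-distribʳ-+S : _·S_ DistributesOverʳ _+S_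
  ·S-distribʳ-+S P Q R = ≐⇒≈S ((Q +S R) ·S P) ((Q ·S P) +S (R ·S P)) (begin
    ⟦ (Q +S R) ·S P ⟧                 ≈⟨ ⟦·S⟧ (Q +S R) P ⟩
    ⟦ Q +S R ⟧ ⊙ ⟦ P ⟧                ≈⟨ ⊙-cong (⟦+S⟧ Q R) ≐-refl ⟩
    (⟦ Q ⟧ ∪ ⟦ R ⟧) ⊙ ⟦ P ⟧           ≈⟨ ⊙-distribʳ-∪ ⟦ P ⟧ ⟦ Q ⟧ ⟦ R ⟧ ⟩
    (⟦ Q ⟧ ⊙ ⟦ P ⟧) ∪ (⟦ R ⟧ ⊙ ⟦ P ⟧) ≈⟨ ∪-cong (⟦·S⟧ Q P) (⟦·S⟧ R P) ⟨
    ⟦ Q ·S P ⟧ ∪ ⟦ R ·S P ⟧           ≈⟨ ⟦+S⟧ (Q ·S P) (R ·S P) ⟨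
    ⟦ (Q ·S P) +S (R ·S P) ⟧          ∎)

  ·S-zeroˡ : LeftZero 0S _·S_
  ·S-zeroˡ _ _ = id , id

  +S-·S-absorptive : ∀ (P Q : S∞ n) → (P +S (P ·S Q)) ≈S P
  +S-·S-absorptive P Q = ≐⇒≈S (P +S (P ·S Q)) P (begin
    ⟦ P +S (P ·S Q) ⟧        ≈⟨ ⟦+S⟧ P (P ·S Q) ⟩
    ⟦ P ⟧ ∪ ⟦ P ·S Q ⟧       ≈⟨ ∪-cong ≐-refl (⟦·S⟧ P Q) ⟩
    ⟦ P ⟧ ∪ (⟦ P ⟧ ⊙ ⟦ Q ⟧)  ≈⟨ ∪-⊙-absorbs ⟦ Q ⟧ ↓-downClosed ⟩
    ⟦ P ⟧                    ∎)

  +S-isCommutativeMonoid : IsCommutativeMonoid (_≈S_ {n}) _+S_ 0S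
  +S-isCommutativeMonoid = isCommutativeMonoidˡ record
    { isSemigroup = record
      { isMagma = record { isEquivalence = ≈S-isEquivalence ; ∙-cong = λ {P P′ Q Q′} → +S-cong {P} {P′} {Q} {Q′} }
      ; assoc   = +S-assoc
      }
    ; identityˡ = +S-identityˡ
    ; comm      = +S-comm
    }

  ·S-isCommutativeMonoid : IsCommutativeMonoid (_≈S_ {n}) _·S_ 1S
  ·S-isCommutativeMonoid = isCommutativeMonoidˡ record
    { isSemigroup = record
      { isMagma = record { isEquivalence = ≈S-isEquivalence ; ∙-cong = λ {P P′ Q Q′} → ·S-cong {P} {P′} {Q} {Q′} }
      ; assoc   = ·S-assoc
      }
    ; identityˡ = ·S-identityˡ
    ; comm      = ·S-comm
    }

  +S-·S-isCommutativeSemiring : IsCommutativeSemiring (_≈S_ {n}) _+S_ _·S_ 0S 1S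
  +S-·S-isCommutativeSemiring = isCommutativeSemiringˡ record
    { +-isCommutativeMonoid = +S-isCommutativeMonoid
    ; *-isCommutativeMonoid = ·S-isCommutativeMonoid
    ; distribʳ              = ·S-distribʳ-+S
    ; zeroˡ                 = ·S-zeroˡ
    }

FinitelyGenerated : ∀ {n} → Pred (Mon n) 0ℓ → Set
FinitelyGenerated U = ∃ λ l → ↓ l ≐ U

uniformBound : ∀ {A : Set} (P : ℕ → A → Set) → (∀ {j k x} → j ≤ k → P j x → P k x) →
               ∀ (xs : List A) → (∀ {x} → x ∈ xs → ∃ λ k → P k x) → ∃ λ K → ∀ {x} → x ∈ xs → P K x
uniformBound P mono []       _     = 0 , λ ()
uniformBound P mono (x ∷ xs) bound with bound (here refl) | uniformBound P mono xs (bound ∘ there)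
... | k , Pkx | K , PK = k ⊔ K , λ { (here refl) → mono (ℕ.m≤m⊔n k K) Pkx
                                   ; (there y∈)  → mono (ℕ.m≤n⊔m k K) (PK y∈) }

↓-map-∷⁺ : ∀ {n} {k k′} {l : List (Mon n)} {v} → k ≤∞ k′ → ↓ l v → ↓ (map (k ∷_) l) (k′ ∷ v)
↓-map-∷⁺ k≤k′ d = Any.map⁺ (Any.map (k≤k′ ∷_) d)

module _ (lem : ExcludedMiddle 0ℓ) where

  -- Dickson's lemma, by induction on the number of variables: the slices U(k, -) are finitely
  -- generated, and they stop growing at some finite K, so the slices at ∞ and 0, …, K suffice.
  downClosed⇒finitelyGenerated : ∀ {n} {U : Pred (Mon n) 0ℓ} → DownClosed U → FinitelyGenerated U
  downClosed⇒finitelyGenerated {zero} {U} _ with lem {U []}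
  ... | yes U[] = ([] ∷ []) , (λ { {[]} _ → U[] }) , (λ { {[]} _ → here [] })
  ... | no ¬U[] = [] , (λ ()) , (λ { {[]} U[] → ⊥-elim (¬U[] U[]) })
  downClosed⇒finitelyGenerated {suc n} {U} U↓ = generators , ↓-least U↓ generator⇒U , complete
    where
    slice : ∀ k → FinitelyGenerated (λ v → U (k ∷ v))
    slice k = downClosed⇒finitelyGenerated (λ Ukv v⪰w → U↓ Ukv (≤∞-refl ∷ v⪰w))

    finiteExponent : FinitelyGenerated (λ v → ∃ λ j → U (fin j ∷ v))
    finiteExponent = downClosed⇒finitelyGenerated (λ (j , Ujv) v⪰w → j , U↓ Ujv (≤∞-refl ∷ v⪰w))

    bound : ∃ λ K → ∀ {g} → g ∈ proj₁ finiteExponent → U (fin K ∷ g)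
    bound = uniformBound (λ k g → U (fin k ∷ g)) (λ j≤k Ujg → U↓ Ujg (fin≤fin j≤k ∷ ⪰-refl))
              (proj₁ finiteExponent) (λ g∈ → proj₁ (proj₂ finiteExponent) (∈⇒↓ g∈))

    K : ℕ
    K = proj₁ bound

    stable : ∀ {j v} → U (fin j ∷ v) → U (fin K ∷ v)
    stable Ujv with find (proj₂ (proj₂ finiteExponent) (_ , Ujv))
    ... | g , g∈ , g⪰v = U↓ (proj₂ bound g∈) (≤∞-refl ∷ g⪰v)

    layer : ℕ∞ → List (Mon (suc n))
    layer k = map (k ∷_) (proj₁ (slice k))

    exponents : List ℕ∞
    exponents = ∞ ∷ map fin (upTo (suc K))

    generators : List (Mon (suc n))
    generators = concatMap layer exponents

    generator⇒U : ∀ {x} → x ∈ generators → U x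
    generator⇒U x∈ with find (∈-concatMap⁻ layer {exponents} x∈)
    ... | k , _ , x∈layer with ∈-map⁻ (k ∷_) x∈layer
    ...   | g , g∈ , refl = proj₁ (proj₂ (slice k)) (∈⇒↓ g∈)

    inLayer : ∀ {k k′ v} → k ≤∞ k′ → U (k ∷ v) → ↓ (layer k) (k′ ∷ v)
    inLayer k≤k′ Ukv = ↓-map-∷⁺ k≤k′ (proj₂ (proj₂ (slice _)) Ukv)

    finiteLayer : ∀ {k m} → k ≤ K → ↓ (layer (fin k)) m → ↓ generators m
    finiteLayer k≤K d = Any.concatMap⁺ layer {xs = exponents} (there (Any.map⁺ (lose (∈-upTo⁺ (s≤s k≤K)) d)))

    complete : U ⊆ ↓ generators
    complete {∞ ∷ v} Uv = Any.concatMap⁺ layer {xs = exponents} (here (inLayer ≤∞-refl Uv))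
    complete {fin j ∷ v} Uv with j ≤? K
    ... | yes j≤K = finiteLayer j≤K (inLayer ≤∞-refl Uv)
    ... | no  j≰K = finiteLayer ℕ.≤-refl (inLayer (fin≤fin (ℕ.≰⇒≥ j≰K)) (stable Uv))

  downClosed⇒representable : ∀ {n} {U : Pred (Mon n) 0ℓ} → DownClosed U → ∃ λ (P : S∞ n) → ⟦ P ⟧ ≐ U
  downClosed⇒representable U↓ with downClosed⇒finitelyGenerated U↓
  ... | l , l≐U = normal l , ≐-trans (↓-maxs l) l≐U

module _ (lem : ExcludedMiddle 0ℓ) where

  -- An element outside one member of the chain is outside all smaller members, so it can be
  -- discarded without losing the hypothesis.
  any-⋂-chain : ∀ {A I : Set} (P : I → Pred A 0ℓ) → I → (∀ i j → P i ⊆ P j ⊎ P j ⊆ P i) →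
                ∀ (xs : List A) → (∀ i → Any (P i) xs) → Any (λ x → ∀ i → P i x) xs
  any-⋂-chain P i₀ chain [] meets with meets i₀
  ... | ()
  any-⋂-chain P i₀ chain (x ∷ xs) meets with lem {∀ i → P i x}
  ... | yes x∈⋂ = here x∈⋂
  ... | no  x∉⋂ = there (any-⋂-chain P i₀ chain xs meetsTail)
    where
    dne = em⇒dne lem

    witness : ∃ λ i₁ → ¬ P i₁ x
    witness = dne (λ ∄ → x∉⋂ (λ i → dne (λ ¬Pix → ∄ (i , ¬Pix))))

    i₁ = proj₁ witness
    x∉Pi₁ = proj₂ witness

    meetsTail : ∀ i → Any (P i) xs
    meetsTail i with chain i i₁ | meets i | meets i₁
    ... | inj₁ Pi⊆Pi₁ | here Pix  | _          = ⊥-elim (x∉Pi₁ (Pi⊆Pi₁ Pix))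
    ... | inj₁ _      | there any | _          = any
    ... | inj₂ _      | _         | here Pi₁x  = ⊥-elim (x∉Pi₁ Pi₁x)
    ... | inj₂ Pi₁⊆Pi | _         | there any = Any.map Pi₁⊆Pi any

  ∪-⋂-distrib : ∀ {n} {I : Set} {U : I → Pred (Mon n) 0ℓ} (A : Pred (Mon n) 0ℓ) →
                A ∪ ⋂ I U ≐ ⋂ I (λ i → A ∪ U i)
  ∪-⋂-distrib {I = I} {U} A = [ (λ Am _ → inj₁ Am) , (λ Um i → inj₂ (Um i)) ] , from
    where
    from : ⋂ I (λ i → A ∪ U i) ⊆ A ∪ ⋂ I U
    from {m} AU with lem {A m}
    ... | yes Am = inj₁ Am
    ... | no ¬Am = inj₂ (λ i → [ (λ Am → ⊥-elim (¬Am Am)) , id ] (AU i))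

  -- One x ∈ l serves every U i (by any-⋂-chain); every cofactor p with x ·m p ⪰ m absorbs
  -- the residual m ∸m x, which therefore lies in every U i.
  ↓⊙-⋂-distrib : ∀ {n} {I : Set} {U : I → Pred (Mon n) 0ℓ} (l : List (Mon n)) → I →
                 (∀ i → DownClosed (U i)) → (∀ i j → U i ⊆ U j ⊎ U j ⊆ U i) →
                 ↓ l ⊙ ⋂ I U ≐ ⋂ I (λ i → ↓ l ⊙ U i)
  ↓⊙-⋂-distrib {I = I} {U} l i₀ U↓ chain = (λ (a , b , la , Ub , p) i → a , b , la , Ub i , p) , from
    where
    from : ⋂ I (λ i → ↓ l ⊙ U i) ⊆ ↓ l ⊙ ⋂ I U
    from {m} h =
      let x , x∈l , reachesAll = find (any-⋂-chain Reaches i₀ reachesChain l reaches)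
          p₀ , _ , xp₀⪰m = reachesAll i₀
      in x , m ∸m x , ∈⇒↓ x∈l ,
         (λ i → let p , Uip , xp⪰m = reachesAll i in U↓ i Uip (x·p⪰m⇒p⪰m∸x xp⪰m)) ,
         x·[m∸x]⪰m (⪰-trans (a⪰a·b x p₀) xp₀⪰m)
      where
      Reaches : I → Pred (Mon _) 0ℓ
      Reaches i x = ∃ λ p → U i p × (x ·m p) ⪰ m

      reachesChain : ∀ i j → Reaches i ⊆ Reaches j ⊎ Reaches j ⊆ Reaches i
      reachesChain i j = Sum.map (λ Ui⊆Uj (p , Uip , xp⪰m) → p , Ui⊆Uj Uip , xp⪰m)
                                 (λ Uj⊆Ui (p , Ujp , xp⪰m) → p , Uj⊆Ui Ujp , xp⪰m) (chain i j)

      reaches : ∀ i → Any (Reaches i) l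
      reaches i with h i
      ... | a , b , la , Uib , ab⪰m = Any.map (λ x⪰a → b , Uib , ⪰-trans (·m-mono-⪰ x⪰a ⪰-refl) ab⪰m) la

-- The natural order is inclusion of down-sets

module _ {n : ℕ} where
  open SemiringNotions (_≈S_ {n}) _+S_ _·S_ 0S 1S

  ⋃[_]_ : (S∞ n → Set) → (S∞ n → Pred (Mon n) 0ℓ) → Pred (Mon n) 0ℓ
  ⋃[ C ] U = ⋃ (Σ (S∞ n) C) (U ∘ proj₁)

  ⋂[_]_ : (S∞ n → Set) → (S∞ n → Pred (Mon n) 0ℓ) → Pred (Mon n) 0ℓ
  ⋂[ C ] U = ⋂ (Σ (S∞ n) C) (U ∘ proj₁)

  ⊑⇒⊆ : ∀ (P Q : S∞ n) → P ⊑ Q → ⟦ P ⟧ ⊆ ⟦ Q ⟧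
  ⊑⇒⊆ P Q (R , P+R≈Q) d = proj₁ (≈S⇒≐ (P +S R) Q P+R≈Q) (proj₂ (⟦+S⟧ P R) (inj₁ d))

  ⊆⇒⊑ : ∀ (P Q : S∞ n) → ⟦ P ⟧ ⊆ ⟦ Q ⟧ → P ⊑ Q
  ⊆⇒⊑ P Q P⊆Q = Q , ≐⇒≈S (P +S Q) Q (≐-trans (⟦+S⟧ P Q) ([ P⊆Q , id ] , inj₂))

  isChain⇒⊆-chain : ∀ {C} → IsChain C → ∀ (c c′ : Σ (S∞ n) C) →
                    ⟦ proj₁ c ⟧ ⊆ ⟦ proj₁ c′ ⟧ ⊎ ⟦ proj₁ c′ ⟧ ⊆ ⟦ proj₁ c ⟧
  isChain⇒⊆-chain chain (c , Cc) (c′ , Cc′) = Sum.map (⊑⇒⊆ c c′) (⊑⇒⊆ c′ c) (chain c c′ Cc Cc′)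

  ≐⋃⇒isSup : ∀ C s → ⟦ s ⟧ ≐ ⋃[ C ] ⟦_⟧ → IsSup C s
  ≐⋃⇒isSup C s (s⊆⋃ , ⋃⊆s) =
    (λ c Cc → ⊆⇒⊑ c s (λ d → ⋃⊆s ((c , Cc) , d))) ,
    (λ u upper → ⊆⇒⊑ s u (λ d → let (c , Cc) , dc = s⊆⋃ d in ⊑⇒⊆ c u (upper c Cc) dc))

  ≐⋂⇒isInf : ∀ C i → ⟦ i ⟧ ≐ ⋂[ C ] ⟦_⟧ → IsInf C i
  ≐⋂⇒isInf C i (i⊆⋂ , ⋂⊆i) =
    (λ c Cc → ⊆⇒⊑ i c (λ d → i⊆⋂ d (c , Cc))) ,
    (λ l lower → ⊆⇒⊑ l i (λ d → ⋂⊆i (λ (c , Cc) → ⊑⇒⊆ l c (lower c Cc) d)))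

  isSup-unique : ∀ C s s′ → IsSup C s → IsSup C s′ → ⟦ s ⟧ ≐ ⟦ s′ ⟧
  isSup-unique C s s′ (upper , least) (upper′ , least′) =
    ⊑⇒⊆ s s′ (least s′ upper′) , ⊑⇒⊆ s′ s (least′ s upper)

  isInf-unique : ∀ C i i′ → IsInf C i → IsInf C i′ → ⟦ i ⟧ ≐ ⟦ i′ ⟧
  isInf-unique C i i′ (lower , greatest) (lower′ , greatest′) =
    ⊑⇒⊆ i i′ (greatest′ i lower) , ⊑⇒⊆ i′ i (greatest i′ lower′)

  module _ {f : S∞ n → S∞ n} {F : Pred (Mon n) 0ℓ → Pred (Mon n) 0ℓ}
           (⟦f⟧ : ∀ x → ⟦ f x ⟧ ≐ F ⟦ x ⟧) (C : S∞ n → Set) where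

    ⋃-Image : ⋃[ Image f C ] ⟦_⟧ ≐ ⋃[ C ] (F ∘ ⟦_⟧)
    ⋃-Image =
      (λ ((y , c , Cc , y≈fc) , dy) → (c , Cc) , proj₁ (⟦f⟧ c) (proj₁ (≈S⇒≐ y (f c) y≈fc) dy)) ,
      (λ ((c , Cc) , d) → (f c , c , Cc , IsEquivalence.refl ≈S-isEquivalence {f c}) , proj₂ (⟦f⟧ c) d)

    ⋂-Image : ⋂[ Image f C ] ⟦_⟧ ≐ ⋂[ C ] (F ∘ ⟦_⟧)
    ⋂-Image =
      (λ h (c , Cc) → proj₁ (⟦f⟧ c) (h (f c , c , Cc , IsEquivalence.refl ≈S-isEquivalence {f c}))) ,
      (λ h (y , c , Cc , y≈fc) → proj₂ (≈S⇒≐ y (f c) y≈fc) (proj₂ (⟦f⟧ c) (h (c , Cc))))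

  ⟦⟧-∞m : ∀ (P : S∞ n) → ¬ (P ≈S 0S) → ⟦ P ⟧ ∞m
  ⟦⟧-∞m ([]    , _) P≉0 = ⊥-elim (P≉0 (λ _ → id , id))
  ⟦⟧-∞m (x ∷ _ , _) _   = here (a⪰∞m x)

  ⟦⟧-inhabited⇒≉0S : ∀ (P : S∞ n) {m} → ⟦ P ⟧ m → ¬ (P ≈S 0S)
  ⟦⟧-inhabited⇒≉0S P d P≈0 with find d
  ... | x , x∈P , _ with proj₁ (P≈0 x) x∈P
  ...   | ()

module _ (lem : ExcludedMiddle 0ℓ) {n : ℕ} where
  open SemiringNotions (_≈S_ {n}) _+S_ _·S_ 0S 1S
  open SetoidReasoning (≐-setoid (Mon n) 0ℓ)

  ⋃-representable : ∀ (C : S∞ n → Set) → ∃ λ S → ⟦ S ⟧ ≐ ⋃[ C ] ⟦_⟧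
  ⋃-representable C = downClosed⇒representable lem (⋃-downClosed (λ _ → ↓-downClosed))

  ⋂-representable : ∀ (C : S∞ n → Set) → ∃ λ I → ⟦ I ⟧ ≐ ⋂[ C ] ⟦_⟧
  ⋂-representable C = downClosed⇒representable lem (⋂-downClosed (λ _ → ↓-downClosed))

  isSup⇒≐⋃ : ∀ C s → IsSup C s → ⟦ s ⟧ ≐ ⋃[ C ] ⟦_⟧
  isSup⇒≐⋃ C s s-sup = let S , S≐⋃ = ⋃-representable C in
    ≐-trans (isSup-unique C s S s-sup (≐⋃⇒isSup C S S≐⋃)) S≐⋃

  isInf⇒≐⋂ : ∀ C i → IsInf C i → ⟦ i ⟧ ≐ ⋂[ C ] ⟦_⟧
  isInf⇒≐⋂ C i i-inf = let I , I≐⋂ = ⋂-representable C in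
    ≐-trans (isInf-unique C i I i-inf (≐⋂⇒isInf C I I≐⋂)) I≐⋂

  fullyChainComplete : FullyChainComplete
  fullyChainComplete C _ = let S , S≐⋃ = ⋃-representable C ; I , I≐⋂ = ⋂-representable C in
    (S , ≐⋃⇒isSup C S S≐⋃) , (I , ≐⋂⇒isInf C I I≐⋂)

  preservesChainLimits : ∀ f (F : Pred (Mon n) 0ℓ → Pred (Mon n) 0ℓ) →
    (∀ {U V} → U ≐ V → F U ≐ F V) → (∀ x → ⟦ f x ⟧ ≐ F ⟦ x ⟧) →
    (∀ C → IsChain C → NonEmpty C → F (⋃[ C ] ⟦_⟧) ≐ ⋃[ C ] (F ∘ ⟦_⟧)) →
    (∀ C → IsChain C → NonEmpty C → F (⋂[ C ] ⟦_⟧) ≐ ⋂[ C ] (F ∘ ⟦_⟧)) →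
    PreservesChainLimits f
  preservesChainLimits f F F-cong ⟦f⟧ F-⋃ F-⋂ C chain nonEmpty =
    (λ s s-sup → ≐⋃⇒isSup (Image f C) (f s) (begin
      ⟦ f s ⟧                ≈⟨ ⟦f⟧ s ⟩
      F ⟦ s ⟧                ≈⟨ F-cong (isSup⇒≐⋃ C s s-sup) ⟩
      F (⋃[ C ] ⟦_⟧)         ≈⟨ F-⋃ C chain nonEmpty ⟩
      ⋃[ C ] (F ∘ ⟦_⟧)       ≈⟨ ⋃-Image {f = f} {F = F} ⟦f⟧ C ⟨
      ⋃[ Image f C ] ⟦_⟧     ∎)) ,
    (λ i i-inf → ≐⋂⇒isInf (Image f C) (f i) (begin
      ⟦ f i ⟧                ≈⟨ ⟦f⟧ i ⟩
      F ⟦ i ⟧                ≈⟨ F-cong (isInf⇒≐⋂ C i i-inf) ⟩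
      F (⋂[ C ] ⟦_⟧)         ≈⟨ F-⋂ C chain nonEmpty ⟩
      ⋂[ C ] (F ∘ ⟦_⟧)       ≈⟨ ⋂-Image {f = f} {F = F} ⟦f⟧ C ⟨
      ⋂[ Image f C ] ⟦_⟧     ∎))

  preservesChainLimits-∪ : ∀ (a : S∞ n) f → (∀ x → ⟦ f x ⟧ ≐ ⟦ a ⟧ ∪ ⟦ x ⟧) → PreservesChainLimits f
  preservesChainLimits-∪ a f ⟦f⟧ = preservesChainLimits f (⟦ a ⟧ ∪_) (∪-cong ≐-refl) ⟦f⟧
    (λ _ _ c₀ → ∪-⋃-distrib ⟦ a ⟧ c₀)
    (λ _ _ _ → ∪-⋂-distrib lem ⟦ a ⟧)

  preservesChainLimits-⊙ : ∀ (a : S∞ n) f → (∀ x → ⟦ f x ⟧ ≐ ⟦ a ⟧ ⊙ ⟦ x ⟧) → PreservesChainLimits f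
  preservesChainLimits-⊙ a f ⟦f⟧ = preservesChainLimits f (⟦ a ⟧ ⊙_) (⊙-cong ≐-refl) ⟦f⟧
    (λ _ _ _ → ⊙-⋃-distrib ⟦ a ⟧)
    (λ _ chain c₀ → ↓⊙-⋂-distrib lem (proj₁ a) c₀ (λ _ → ↓-downClosed) (isChain⇒⊆-chain chain))

  fullyContinuous : FullyContinuous
  fullyContinuous = fullyChainComplete , λ a →
    preservesChainLimits-∪ a (a +S_) (⟦+S⟧ a) ,
    preservesChainLimits-∪ a (_+S a) (λ x → ≐-trans (⟦+S⟧ x a) (∪-comm ⟦ x ⟧ ⟦ a ⟧)) ,
    preservesChainLimits-⊙ a (a ·S_) (⟦·S⟧ a) ,
    preservesChainLimits-⊙ a (_·S a) (λ x → ≐-trans (⟦·S⟧ x a) (⊙-comm ⟦ x ⟧ ⟦ a ⟧))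

  chainPositive : ChainPositive
  chainPositive C _ _ C≉0 i i-inf =
    ⟦⟧-inhabited⇒≉0S i (proj₂ (isInf⇒≐⋂ C i i-inf) (λ (c , Cc) → ⟦⟧-∞m c (C≉0 c Cc)))

proposition23 : ExcludedMiddle 0ℓ → (n : ℕ) →
    let open SemiringNotions (_≈S_ {n}) _+S_ _·S_ 0S 1S in
    IsCommutativeSemiring (_≈S_ {n}) _+S_ _·S_ 0S 1S
      × Absorptive × FullyContinuous × ChainPositive
proposition23 lem n =
  +S-·S-isCommutativeSemiring , +S-·S-absorptive , fullyContinuous lem , chainPositive lem
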